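{- Let $G$ be a nontrivial proper subgroup of $\mathbb{Q}$. If $1\in G$, let $d\in\mathbb{N}$ be such that $\frac1d\notin G$ and let $p=1$; if $1\notin G$, let $d\in\mathbb{N}\cap G$ and let $p=d$. Let $A$ be the $\omega\times2$ matrix whose row $l$ ($l<\omega$) is $(1,\ ld)$. Assume that $C$ is an $\omega\times2$ matrix with rational entries such that $$\{A\vec x:\vec x\in G^2\}\cap(G\setminus\{0\})^\omega\subseteq\{C\vec y:\vec y\in(G\setminus\{0\})^2\}.$$ Then there exist $x_0,x_1\in G\setminus\{0\}$, $m\neq n$ in $\omega$, and $k\in\mathbb{Q}$ such that $k=dx_0x_1(m-n)$ and for all $l<\omega$, $kc_{l,0}=pdx_1(l-n)$ and $kc_{l,1}=pdx_0(m-l)$.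
   Context: $\mathbb{N}$ is the set of positive integers and $\omega=\{0,1,2,\dots\}$; an $\omega\times2$ matrix has rows indexed by $\omega$ and columns by $\{0,1\}$, and $c_{l,j}$ denotes the entry of $C$ in row $l$, column $j$. -}

module Defs where

open import Data.Nat using (ℕ; NonZero)
open import Data.Integer using (+_)
open import Data.Rational using (ℚ; 0ℚ; _+_; _*_; -_; _/_)
open import Data.Fin using (Fin; zero; suc)
open import Data.Product using (Σ; _×_)
open import Relation.Nullary using (¬_)
open import Relation.Binary.PropositionalEquality using (_≡_; _≢_)

ℕ→ℚ : ℕ → ℚ
ℕ→ℚ n = (+ n) / 1

record IsSubgroupℚ (G : ℚ → Set) : Set where
  field
    zero∈ : G 0ℚ
    +∈    : ∀ {x y} → G x → G y → G (x + y)
    -∈    : ∀ {x} → G x → G (- x)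

Nontrivial : (ℚ → Set) → Set
Nontrivial G = Σ ℚ (λ x → G x × x ≢ 0ℚ)

Proper : (ℚ → Set) → Set
Proper G = Σ ℚ (λ x → ¬ G x)

NZ : (ℚ → Set) → ℚ → Set
NZ G x = G x × x ≢ 0ℚ

Mat : Set
Mat = ℕ → Fin 2 → ℚ

Vec2 : Set
Vec2 = Fin 2 → ℚ

_·_ : Mat → Vec2 → ℕ → ℚ
(M · v) l = M l zero * v zero + M l (suc zero) * v (suc zero)

Amat : ℕ → Mat
Amat d l zero = ℕ→ℚ 1
Amat d l (suc zero) = ℕ→ℚ l * ℕ→ℚ d

-- Representing the columns A (p, 0) and A (p, p) gives u, w ∈ (G∖{0})² with C u = (p)ₗ and
-- C v = (l d p)ₗ for v = w - u. Cramer's rule expresses every row of C through u and v, and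
-- det (u, v) ≠ 0 because the second of these columns is not constant; hence C is injective and
-- every representation C y = A (a, b) satisfies p y = a u + b v. For the column A (vᵢ, -uᵢ)
-- this would force yᵢ = 0, so that column has a zero entry, i.e. vᵢ = nᵢ d uᵢ for some nᵢ.
-- Substituting into Cramer's formulas gives the rows of C, scaled by k = -det (u, v).
module Submission where

open import Defs
open import Data.Nat using (ℕ; NonZero)
open import Data.Integer using (+_)
open import Data.Rational using (ℚ; 0ℚ; 1ℚ; _+_; _*_; _-_; _/_)
open import Data.Fin using (Fin; zero; suc)
open import Data.Product using (Σ; _×_; _,_)
open import Data.Sum using (_⊎_)
open import Relation.Nullary using (¬_)
open import Relation.Binary.PropositionalEquality using (_≡_; _≢_)

import Data.Nat as ℕ
import Data.Nat.Properties as ℕ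
import Data.Integer as ℤ
import Data.Integer.Properties as ℤ
import Data.Nat.Coprimality as Coprimality
open import Data.Rational using (mkℚ; -_; 1/_; ≢-nonZero)
open import Data.Rational.Properties
open import Data.Rational.Solver using (module +-*-Solver)
open import Algebra.Properties.Group +-0-group using (x∙y⁻¹≈ε⇒x≈y)
open import Data.Fin.Patterns using (0F; 1F)
open import Data.Vec.Functional using ([]; _∷_)
open import Data.Product using (∃; proj₁; proj₂)
open import Data.Sum using (inj₁; inj₂)
open import Relation.Nullary using (Dec; yes; no)
open import Relation.Nullary.Decidable using (map′; decidable-stable)
open import Relation.Binary.PropositionalEquality
  using (refl; sym; trans; cong; cong₂; subst; module ≡-Reasoning)
open +-*-Solver
open ≡-Reasoning

coprimeTo1 : ∀ n → Coprimality.Coprime n 1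
coprimeTo1 n = Coprimality.sym (Coprimality.1-coprimeTo n)

ℕ→ℚ-normal : ∀ n → ℕ→ℚ n ≡ mkℚ (+ n) 0 (coprimeTo1 n)
ℕ→ℚ-normal n = normalize-coprime (coprimeTo1 n)

ℕ→ℚ-homo-+ : ∀ m n → ℕ→ℚ (m ℕ.+ n) ≡ ℕ→ℚ m + ℕ→ℚ n
ℕ→ℚ-homo-+ m n
  rewrite ℕ→ℚ-normal m | ℕ→ℚ-normal n | ℕ.*-identityʳ m | ℕ.*-identityʳ n | ℤ.+◃n≡+n m | ℤ.+◃n≡+n n
  = sym (cong (_/ 1) (ℤ.pos-+ m n))

ℕ→ℚ-homo-* : ∀ m n → ℕ→ℚ (m ℕ.* n) ≡ ℕ→ℚ m * ℕ→ℚ n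
ℕ→ℚ-homo-* m n rewrite ℕ→ℚ-normal m | ℕ→ℚ-normal n | ℤ.+◃n≡+n (m ℕ.* n) = refl

ℕ→ℚ≢0 : ∀ n .{{_ : NonZero n}} → ℕ→ℚ n ≢ 0ℚ
ℕ→ℚ≢0 (ℕ.suc n) eq with trans (sym (ℕ→ℚ-normal (ℕ.suc n))) eq
... | ()

natural? : (q : ℚ) → Dec (∃ λ n → q ≡ ℕ→ℚ n)
natural? (mkℚ (+ n) 0 _) = yes (n , sym (ℕ→ℚ-normal n))
natural? (mkℚ (+ n) (ℕ.suc k) c) = no λ (m , eq) → noncanonical (trans eq (ℕ→ℚ-normal m))
  where
  noncanonical : ∀ {m} → mkℚ (+ n) (ℕ.suc k) c ≢ mkℚ (+ m) 0 (coprimeTo1 m)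
  noncanonical ()
natural? (mkℚ ℤ.-[1+ n ] k c) = no λ (m , eq) → negative (trans eq (ℕ→ℚ-normal m))
  where
  negative : ∀ {m} → mkℚ ℤ.-[1+ n ] k c ≢ mkℚ (+ m) 0 (coprimeTo1 m)
  negative ()

p*q≡0⇒q≡0 : ∀ {p q} → p ≢ 0ℚ → p * q ≡ 0ℚ → q ≡ 0ℚ
p*q≡0⇒q≡0 {p} {q} p≢0 pq≡0 = begin
  q                ≡⟨ sym (*-identityˡ q) ⟩
  1ℚ * q           ≡⟨ cong (_* q) (sym (*-inverseˡ p)) ⟩
  (1/ p) * p * q   ≡⟨ *-assoc (1/ p) p q ⟩
  (1/ p) * (p * q) ≡⟨ cong ((1/ p) *_) pq≡0 ⟩
  (1/ p) * 0ℚ      ≡⟨ *-zeroʳ (1/ p) ⟩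
  0ℚ               ∎
  where instance _ = ≢-nonZero p≢0

p*q≢0 : ∀ {p q} → p ≢ 0ℚ → q ≢ 0ℚ → p * q ≢ 0ℚ
p*q≢0 p≢0 q≢0 pq≡0 = q≢0 (p*q≡0⇒q≡0 p≢0 pq≡0)

ℕ-multiple? : ∀ {x} → x ≢ 0ℚ → (q : ℚ) → Dec (∃ λ n → q ≡ ℕ→ℚ n * x)
ℕ-multiple? {x} x≢0 q = map′ (λ (n , eq) → n , multiply n eq) (λ (n , eq) → n , divide n eq)
                              (natural? (q * 1/ x))
  where
  instance _ = ≢-nonZero x≢0
  multiply : ∀ n → q * 1/ x ≡ ℕ→ℚ n → q ≡ ℕ→ℚ n * x
  multiply n eq = begin
    q                ≡⟨ sym (*-identityʳ q) ⟩
    q * 1ℚ           ≡⟨ cong (q *_) (sym (*-inverseˡ x)) ⟩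
    q * (1/ x * x)   ≡⟨ sym (*-assoc q (1/ x) x) ⟩
    q * 1/ x * x     ≡⟨ cong (_* x) eq ⟩
    ℕ→ℚ n * x        ∎
  divide : ∀ n → q ≡ ℕ→ℚ n * x → q * 1/ x ≡ ℕ→ℚ n
  divide n eq = begin
    q * 1/ x           ≡⟨ cong (_* 1/ x) eq ⟩
    ℕ→ℚ n * x * 1/ x   ≡⟨ *-assoc (ℕ→ℚ n) x (1/ x) ⟩
    ℕ→ℚ n * (x * 1/ x) ≡⟨ cong (ℕ→ℚ n *_) (*-inverseʳ x) ⟩
    ℕ→ℚ n * 1ℚ         ≡⟨ *-identityʳ (ℕ→ℚ n) ⟩
    ℕ→ℚ n              ∎

affine-two-roots : ∀ {s s′ a b} → s ≢ s′ → a + s * b ≡ 0ℚ → a + s′ * b ≡ 0ℚ → a ≡ 0ℚ × b ≡ 0ℚ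
affine-two-roots {s} {s′} {a} {b} s≢s′ root root′ = a≡0 , b≡0
  where
  b≡0 : b ≡ 0ℚ
  b≡0 = p*q≡0⇒q≡0 (λ s-s′≡0 → s≢s′ (x∙y⁻¹≈ε⇒x≈y s s′ s-s′≡0)) (begin
    (s - s′) * b                    ≡⟨ solve 4 (λ s s′ a b → (s :- s′) :* b := (a :+ s :* b) :- (a :+ s′ :* b))
                                               refl s s′ a b ⟩
    (a + s * b) - (a + s′ * b)      ≡⟨ cong₂ _-_ root root′ ⟩
    0ℚ                              ∎)
  a≡0 : a ≡ 0ℚ
  a≡0 = begin
    a          ≡⟨ solve 2 (λ a s → a := a :+ s :* con 0ℚ) refl a s ⟩
    a + s * 0ℚ ≡⟨ cong (λ b → a + s * b) (sym b≡0) ⟩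
    a + s * b  ≡⟨ root ⟩
    0ℚ         ∎

linear-combination≡0 : ∀ {a b} → a ≡ 0ℚ → b ≡ 0ℚ → ∀ x y → x * a + y * b ≡ 0ℚ
linear-combination≡0 refl refl x y = solve 2 (λ x y → x :* con 0ℚ :+ y :* con 0ℚ := con 0ℚ) refl x y

det : Vec2 → Vec2 → ℚ
det u v = u 0F * v 1F - u 1F * v 0F

cramer : ∀ (C : Mat) l {u v r s} → (C · u) l ≡ r → (C · v) l ≡ s →
         C l 0F * det u v ≡ r * v 1F - s * u 1F × C l 1F * det u v ≡ s * u 0F - r * v 0F
cramer C l {u} {v} refl refl =
    solve 6 (λ c₀ c₁ u₀ u₁ v₀ v₁ → c₀ :* (u₀ :* v₁ :- u₁ :* v₀)
               := (c₀ :* u₀ :+ c₁ :* u₁) :* v₁ :- (c₀ :* v₀ :+ c₁ :* v₁) :* u₁)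
            refl (C l 0F) (C l 1F) (u 0F) (u 1F) (v 0F) (v 1F)
  , solve 6 (λ c₀ c₁ u₀ u₁ v₀ v₁ → c₁ :* (u₀ :* v₁ :- u₁ :* v₀)
               := (c₀ :* v₀ :+ c₁ :* v₁) :* u₀ :- (c₀ :* u₀ :+ c₁ :* u₁) :* v₀)
            refl (C l 0F) (C l 1F) (u 0F) (u 1F) (v 0F) (v 1F)

module _ {G : ℚ → Set} (G-subgroup : IsSubgroupℚ G) where
  open IsSubgroupℚ G-subgroup

  x-y∈ : ∀ {x y} → G x → G y → G (x - y)
  x-y∈ x∈ y∈ = +∈ x∈ (-∈ y∈)

  ℕ*∈ : ∀ k {x} → G x → G (ℕ→ℚ k * x)
  ℕ*∈ 0         {x} _  = subst G (sym (*-zeroˡ x)) zero∈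
  ℕ*∈ (ℕ.suc k) {x} x∈ = subst G (sym suc*x) (+∈ x∈ (ℕ*∈ k x∈))
    where
    suc*x : ℕ→ℚ (ℕ.suc k) * x ≡ x + ℕ→ℚ k * x
    suc*x = begin
      ℕ→ℚ (ℕ.suc k) * x    ≡⟨ cong (_* x) (ℕ→ℚ-homo-+ 1 k) ⟩
      (1ℚ + ℕ→ℚ k) * x     ≡⟨ solve 2 (λ k x → (con 1ℚ :+ k) :* x := x :+ k :* x) refl (ℕ→ℚ k) x ⟩
      x + ℕ→ℚ k * x        ∎

Covers : (ℚ → Set) → ℕ → Mat → Set
Covers G d C = (x : Vec2) → G (x zero) → G (x (suc zero)) →
  ((l : ℕ) → NZ G ((Amat d · x) l)) →
  Σ Vec2 (λ y → NZ G (y zero) × NZ G (y (suc zero)) × ((l : ℕ) → (Amat d · x) l ≡ (C · y) l))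

AffineRows : (ℚ → Set) → ℕ → ℚ → Mat → Set
AffineRows G d p C = Σ ℚ (λ x₀ → Σ ℚ (λ x₁ → NZ G x₀ × NZ G x₁ ×
  Σ ℕ (λ m → Σ ℕ (λ n → m ≢ n × Σ ℚ (λ k →
    (k ≡ ℕ→ℚ d * x₀ * x₁ * (ℕ→ℚ m - ℕ→ℚ n)) ×
    ((l : ℕ) → (k * C l zero ≡ p * ℕ→ℚ d * x₁ * (ℕ→ℚ l - ℕ→ℚ n))
             × (k * C l (suc zero) ≡ p * ℕ→ℚ d * x₀ * (ℕ→ℚ m - ℕ→ℚ l))))))))

module _ {G : ℚ → Set} (G-subgroup : IsSubgroupℚ G) (d : ℕ) (d≢0 : ℕ→ℚ d ≢ 0ℚ)
         (C : Mat) (covers : Covers G d C) (p : ℚ) (p∈G : G p) (p≢0 : p ≢ 0ℚ) where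
  open IsSubgroupℚ G-subgroup

  ld : ℕ → ℚ
  ld l = ℕ→ℚ l * ℕ→ℚ d

  record Representation (a b : ℚ) : Set where
    field
      vector   : Vec2
      nonzero∈ : ∀ i → NZ G (vector i)
      equation : ∀ l → (C · vector) l ≡ a + ld l * b
  open Representation

  represent : ∀ {a b} → G a → G b → (∀ l → a + ld l * b ≢ 0ℚ) → Representation a b
  represent {a} {b} a∈ b∈ entry≢0 =
    let (y , y₀∈ , y₁∈ , Ax≡Cy) = covers (a ∷ b ∷ []) a∈ b∈ λ l →
          subst (NZ G) (sym (A-entry l)) (entry∈ l , entry≢0 l)
    in record { vector   = y
              ; nonzero∈ = λ { 0F → y₀∈ ; 1F → y₁∈ }
              ; equation = λ l → trans (sym (Ax≡Cy l)) (A-entry l) }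
    where
    A-entry : ∀ l → (Amat d · (a ∷ b ∷ [])) l ≡ a + ld l * b
    A-entry l = cong (_+ ld l * b) (*-identityˡ a)
    entry∈ : ∀ l → G (a + ld l * b)
    entry∈ l = +∈ a∈ (subst G (sym (*-assoc (ℕ→ℚ l) (ℕ→ℚ d) b))
                               (ℕ*∈ G-subgroup l (ℕ*∈ G-subgroup d b∈)))

  u-rep : Representation p 0ℚ
  u-rep = represent p∈G zero∈ λ l p≡0 →
    p≢0 (trans (solve 2 (λ p t → p := p :+ t :* con 0ℚ) refl p (ld l)) p≡0)

  w-rep : Representation p p
  w-rep = represent p∈G p∈G λ l → subst (_≢ 0ℚ) (entry l) (p*q≢0 (ℕ→ℚ≢0 (ℕ.suc (l ℕ.* d))) p≢0)
    where
    entry : ∀ l → ℕ→ℚ (ℕ.suc (l ℕ.* d)) * p ≡ p + ld l * p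
    entry l = begin
      ℕ→ℚ (1 ℕ.+ l ℕ.* d) * p      ≡⟨ cong (_* p) (ℕ→ℚ-homo-+ 1 (l ℕ.* d)) ⟩
      (1ℚ + ℕ→ℚ (l ℕ.* d)) * p     ≡⟨ cong (λ t → (1ℚ + t) * p) (ℕ→ℚ-homo-* l d) ⟩
      (1ℚ + ld l) * p              ≡⟨ solve 2 (λ p t → (con 1ℚ :+ t) :* p := p :+ t :* p) refl p (ld l) ⟩
      p + ld l * p                 ∎

  u w v : Vec2
  u = vector u-rep
  w = vector w-rep
  v i = w i - u i

  Cu≡p : ∀ l → (C · u) l ≡ p
  Cu≡p l = trans (equation u-rep l) (solve 2 (λ p t → p :+ t :* con 0ℚ := p) refl p (ld l))

  Cv≡ldp : ∀ l → (C · v) l ≡ ld l * p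
  Cv≡ldp l = begin
    (C · v) l               ≡⟨ solve 6 (λ c₀ c₁ u₀ u₁ w₀ w₁ →
                                    c₀ :* (w₀ :- u₀) :+ c₁ :* (w₁ :- u₁)
                                 := (c₀ :* w₀ :+ c₁ :* w₁) :- (c₀ :* u₀ :+ c₁ :* u₁))
                                refl (C l 0F) (C l 1F) (u 0F) (u 1F) (w 0F) (w 1F) ⟩
    (C · w) l - (C · u) l   ≡⟨ cong₂ _-_ (equation w-rep l) (Cu≡p l) ⟩
    (p + ld l * p) - p      ≡⟨ solve 2 (λ p t → (p :+ t :* p) :- p := t :* p) refl p (ld l) ⟩
    ld l * p                ∎

  Δ : ℚ
  Δ = det u v

  rows-scaled : ∀ l → C l 0F * Δ ≡ p * v 1F - ld l * p * u 1F × C l 1F * Δ ≡ ld l * p * u 0F - p * v 0F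
  rows-scaled l = cramer C l {u} {v} (Cu≡p l) (Cv≡ldp l)

  ld-affine-vanishing : ∀ {a b} → (∀ l → a + ld l * b ≡ 0ℚ) → a ≡ 0ℚ × b ≡ 0ℚ
  ld-affine-vanishing roots = affine-two-roots ld0≢ld1 (roots 0) (roots 1)
    where
    ld0≢ld1 : ld 0 ≢ ld 1
    ld0≢ld1 eq = d≢0 (trans (sym (*-identityˡ (ℕ→ℚ d))) (trans (sym eq) (*-zeroˡ (ℕ→ℚ d))))

  Δ≢0 : Δ ≢ 0ℚ
  Δ≢0 Δ≡0 = p*q≢0 p≢0 (proj₂ (nonzero∈ u-rep 1F)) (neg-injective (proj₂ (ld-affine-vanishing {p * v 1F} roots)))
    where
    roots : ∀ l → p * v 1F + ld l * - (p * u 1F) ≡ 0ℚ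
    roots l = begin
      p * v 1F + ld l * - (p * u 1F) ≡⟨ solve 4 (λ p v₁ t u₁ → p :* v₁ :+ t :* (:- (p :* u₁)) := p :* v₁ :- t :* p :* u₁)
                                                refl p (v 1F) (ld l) (u 1F) ⟩
      p * v 1F - ld l * p * u 1F     ≡⟨ sym (proj₁ (rows-scaled l)) ⟩
      C l 0F * Δ                     ≡⟨ cong (C l 0F *_) Δ≡0 ⟩
      C l 0F * 0ℚ                    ≡⟨ *-zeroʳ (C l 0F) ⟩
      0ℚ                             ∎

  C·-kernel-trivial : ∀ z → (∀ l → (C · z) l ≡ 0ℚ) → ∀ i → z i ≡ 0ℚ
  C·-kernel-trivial z Cz≡0 i = p*q≡0⇒q≡0 Δ≢0 (Δz≡0 i)
    where
    coefficients : p * (v 1F * z 0F - v 0F * z 1F) ≡ 0ℚ × p * (u 0F * z 1F - u 1F * z 0F) ≡ 0ℚ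
    coefficients = ld-affine-vanishing {p * (v 1F * z 0F - v 0F * z 1F)} λ l → begin
      p * (v 1F * z 0F - v 0F * z 1F) + ld l * (p * (u 0F * z 1F - u 1F * z 0F))
        ≡⟨ solve 8 (λ p t u₀ u₁ v₀ v₁ z₀ z₁ →
                p :* (v₁ :* z₀ :- v₀ :* z₁) :+ t :* (p :* (u₀ :* z₁ :- u₁ :* z₀))
             := (p :* v₁ :- t :* p :* u₁) :* z₀ :+ (t :* p :* u₀ :- p :* v₀) :* z₁)
            refl p (ld l) (u 0F) (u 1F) (v 0F) (v 1F) (z 0F) (z 1F) ⟩
      (p * v 1F - ld l * p * u 1F) * z 0F + (ld l * p * u 0F - p * v 0F) * z 1F
        ≡⟨ sym (cong₂ (λ a b → a * z 0F + b * z 1F) (proj₁ (rows-scaled l)) (proj₂ (rows-scaled l))) ⟩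
      C l 0F * Δ * z 0F + C l 1F * Δ * z 1F
        ≡⟨ solve 5 (λ c₀ c₁ δ z₀ z₁ → c₀ :* δ :* z₀ :+ c₁ :* δ :* z₁ := δ :* (c₀ :* z₀ :+ c₁ :* z₁))
            refl (C l 0F) (C l 1F) Δ (z 0F) (z 1F) ⟩
      Δ * (C · z) l
        ≡⟨ cong (Δ *_) (Cz≡0 l) ⟩
      Δ * 0ℚ
        ≡⟨ *-zeroʳ Δ ⟩
      0ℚ ∎
    e₀ : v 1F * z 0F - v 0F * z 1F ≡ 0ℚ
    e₀ = p*q≡0⇒q≡0 p≢0 (proj₁ coefficients)
    e₁ : u 0F * z 1F - u 1F * z 0F ≡ 0ℚ
    e₁ = p*q≡0⇒q≡0 p≢0 (proj₂ coefficients)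
    Δz≡0 : ∀ i → Δ * z i ≡ 0ℚ
    Δz≡0 0F = trans (solve 6 (λ u₀ u₁ v₀ v₁ z₀ z₁ →
                          (u₀ :* v₁ :- u₁ :* v₀) :* z₀
                       := u₀ :* (v₁ :* z₀ :- v₀ :* z₁) :+ v₀ :* (u₀ :* z₁ :- u₁ :* z₀))
                      refl (u 0F) (u 1F) (v 0F) (v 1F) (z 0F) (z 1F))
                    (linear-combination≡0 e₀ e₁ (u 0F) (v 0F))
    Δz≡0 1F = trans (solve 6 (λ u₀ u₁ v₀ v₁ z₀ z₁ →
                          (u₀ :* v₁ :- u₁ :* v₀) :* z₁
                       := u₁ :* (v₁ :* z₀ :- v₀ :* z₁) :+ v₁ :* (u₀ :* z₁ :- u₁ :* z₀))
                      refl (u 0F) (u 1F) (v 0F) (v 1F) (z 0F) (z 1F))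
                    (linear-combination≡0 e₀ e₁ (u 1F) (v 1F))

  representation-formula : ∀ {a b} (r : Representation a b) i → p * vector r i ≡ a * u i + b * v i
  representation-formula {a} {b} r = λ i → x∙y⁻¹≈ε⇒x≈y _ _ (C·-kernel-trivial z Cz≡0 i)
    where
    y z : Vec2
    y = vector r
    z j = p * y j - (a * u j + b * v j)
    Cz≡0 : ∀ l → (C · z) l ≡ 0ℚ
    Cz≡0 l = begin
      (C · z) l
        ≡⟨ solve 11 (λ c₀ c₁ y₀ y₁ u₀ u₁ v₀ v₁ a b p →
                c₀ :* (p :* y₀ :- (a :* u₀ :+ b :* v₀)) :+ c₁ :* (p :* y₁ :- (a :* u₁ :+ b :* v₁))
             := p :* (c₀ :* y₀ :+ c₁ :* y₁)
                :- (a :* (c₀ :* u₀ :+ c₁ :* u₁) :+ b :* (c₀ :* v₀ :+ c₁ :* v₁)))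
            refl (C l 0F) (C l 1F) (y 0F) (y 1F) (u 0F) (u 1F) (v 0F) (v 1F) a b p ⟩
      p * (C · y) l - (a * (C · u) l + b * (C · v) l)
        ≡⟨ cong₂ (λ s t → p * s - t) (equation r l)
                 (cong₂ (λ s t → a * s + b * t) (Cu≡p l) (Cv≡ldp l)) ⟩
      p * (a + ld l * b) - (a * p + b * (ld l * p))
        ≡⟨ solve 4 (λ a b p t → p :* (a :+ t :* b) :- (a :* p :+ b :* (t :* p)) := con 0ℚ)
            refl a b p (ld l) ⟩
      0ℚ ∎

  -- If vᵢ is not a multiple of d uᵢ, the column A (vᵢ, -uᵢ) has no zero entry, so it is C y
  -- for some y with yᵢ ≠ 0; but the representation formula gives p yᵢ = vᵢ uᵢ - uᵢ vᵢ = 0.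
  v≡ℕ*u : ∀ i → ∃ λ n → v i ≡ ℕ→ℚ n * (ℕ→ℚ d * u i)
  v≡ℕ*u i = decidable-stable (ℕ-multiple? (p*q≢0 d≢0 (proj₂ (nonzero∈ u-rep i))) (v i)) λ not-multiple →
    let r = represent v∈ (-∈ u∈) (entry≢0 not-multiple)
    in p*q≢0 p≢0 (proj₂ (nonzero∈ r i)) (trans (representation-formula r i)
         (solve 2 (λ v u → v :* u :+ (:- u) :* v := con 0ℚ) refl (v i) (u i)))
    where
    u∈ : G (u i)
    u∈ = proj₁ (nonzero∈ u-rep i)
    v∈ : G (v i)
    v∈ = x-y∈ G-subgroup (proj₁ (nonzero∈ w-rep i)) u∈
    entry≢0 : ¬ (∃ λ n → v i ≡ ℕ→ℚ n * (ℕ→ℚ d * u i)) → ∀ l → v i + ld l * - u i ≢ 0ℚ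
    entry≢0 not-multiple l root = not-multiple (l , (begin
      v i                                       ≡⟨ solve 4 (λ v L D u → v := (v :+ L :* D :* (:- u)) :+ L :* (D :* u))
                                                           refl (v i) (ℕ→ℚ l) (ℕ→ℚ d) (u i) ⟩
      (v i + ld l * - u i) + ℕ→ℚ l * (ℕ→ℚ d * u i) ≡⟨ cong (_+ ℕ→ℚ l * (ℕ→ℚ d * u i)) root ⟩
      0ℚ + ℕ→ℚ l * (ℕ→ℚ d * u i)                ≡⟨ +-identityˡ _ ⟩
      ℕ→ℚ l * (ℕ→ℚ d * u i)                     ∎))

  m n : ℕ
  m = proj₁ (v≡ℕ*u 0F)
  n = proj₁ (v≡ℕ*u 1F)

  k : ℚ
  k = ℕ→ℚ d * u 0F * u 1F * (ℕ→ℚ m - ℕ→ℚ n)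

  Δ≡-k : Δ ≡ - k
  Δ≡-k = begin
    u 0F * v 1F - u 1F * v 0F
      ≡⟨ cong₂ (λ s t → u 0F * s - u 1F * t) (proj₂ (v≡ℕ*u 1F)) (proj₂ (v≡ℕ*u 0F)) ⟩
    u 0F * (ℕ→ℚ n * (ℕ→ℚ d * u 1F)) - u 1F * (ℕ→ℚ m * (ℕ→ℚ d * u 0F))
      ≡⟨ solve 5 (λ D u₀ u₁ M N → u₀ :* (N :* (D :* u₁)) :- u₁ :* (M :* (D :* u₀))
                               := :- (D :* u₀ :* u₁ :* (M :- N)))
          refl (ℕ→ℚ d) (u 0F) (u 1F) (ℕ→ℚ m) (ℕ→ℚ n) ⟩
    - k ∎

  m≢n : m ≢ n
  m≢n m≡n = Δ≢0 (trans Δ≡-k (cong -_ k≡0))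
    where
    k≡0 : k ≡ 0ℚ
    k≡0 = begin
      ℕ→ℚ d * u 0F * u 1F * (ℕ→ℚ m - ℕ→ℚ n) ≡⟨ cong (λ j → ℕ→ℚ d * u 0F * u 1F * (ℕ→ℚ m - ℕ→ℚ j)) (sym m≡n) ⟩
      ℕ→ℚ d * u 0F * u 1F * (ℕ→ℚ m - ℕ→ℚ m) ≡⟨ solve 4 (λ D u₀ u₁ M → D :* u₀ :* u₁ :* (M :- M) := con 0ℚ)
                                                    refl (ℕ→ℚ d) (u 0F) (u 1F) (ℕ→ℚ m) ⟩
      0ℚ                                    ∎

  k*row : ∀ l → k * C l 0F ≡ p * ℕ→ℚ d * u 1F * (ℕ→ℚ l - ℕ→ℚ n)
              × k * C l 1F ≡ p * ℕ→ℚ d * u 0F * (ℕ→ℚ m - ℕ→ℚ l)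
  k*row l = (begin
      k * C l 0F                    ≡⟨ negate-via-Δ (C l 0F) ⟩
      - (C l 0F * Δ)                ≡⟨ cong -_ (proj₁ (rows-scaled l)) ⟩
      - (p * v 1F - ld l * p * u 1F) ≡⟨ cong (λ t → - (p * t - ld l * p * u 1F)) (proj₂ (v≡ℕ*u 1F)) ⟩
      - (p * (ℕ→ℚ n * (ℕ→ℚ d * u 1F)) - ld l * p * u 1F)
        ≡⟨ solve 5 (λ p D u₁ L N → :- (p :* (N :* (D :* u₁)) :- L :* D :* p :* u₁) := p :* D :* u₁ :* (L :- N))
            refl p (ℕ→ℚ d) (u 1F) (ℕ→ℚ l) (ℕ→ℚ n) ⟩
      p * ℕ→ℚ d * u 1F * (ℕ→ℚ l - ℕ→ℚ n) ∎)
    , (begin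
      k * C l 1F                    ≡⟨ negate-via-Δ (C l 1F) ⟩
      - (C l 1F * Δ)                ≡⟨ cong -_ (proj₂ (rows-scaled l)) ⟩
      - (ld l * p * u 0F - p * v 0F) ≡⟨ cong (λ t → - (ld l * p * u 0F - p * t)) (proj₂ (v≡ℕ*u 0F)) ⟩
      - (ld l * p * u 0F - p * (ℕ→ℚ m * (ℕ→ℚ d * u 0F)))
        ≡⟨ solve 5 (λ p D u₀ L M → :- (L :* D :* p :* u₀ :- p :* (M :* (D :* u₀))) := p :* D :* u₀ :* (M :- L))
            refl p (ℕ→ℚ d) (u 0F) (ℕ→ℚ l) (ℕ→ℚ m) ⟩
      p * ℕ→ℚ d * u 0F * (ℕ→ℚ m - ℕ→ℚ l) ∎)
    where
    negate-via-Δ : ∀ c → k * c ≡ - (c * Δ)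
    negate-via-Δ c = trans (solve 2 (λ k c → k :* c := :- (c :* (:- k))) refl k c) (cong (λ t → - (c * t)) (sym Δ≡-k))

  affineRows : AffineRows G d p C
  affineRows = u 0F , u 1F , nonzero∈ u-rep 0F , nonzero∈ u-rep 1F , m , n , m≢n , k , refl , k*row

lemma3p2 : (G : ℚ → Set) → IsSubgroupℚ G → Nontrivial G → Proper G →
    (d : ℕ) → .{{_ : NonZero d}} → (p : ℚ) →
    ((G 1ℚ × ¬ G ((+ 1) / d) × p ≡ 1ℚ) ⊎ (¬ G 1ℚ × G (ℕ→ℚ d) × p ≡ ℕ→ℚ d)) →
    (C : Mat) →
    ((x : Vec2) → G (x zero) → G (x (suc zero)) →
      ((l : ℕ) → NZ G ((Amat d · x) l)) →
      Σ Vec2 (λ y → NZ G (y zero) × NZ G (y (suc zero)) ×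
        ((l : ℕ) → (Amat d · x) l ≡ (C · y) l))) →
    Σ ℚ (λ x₀ → Σ ℚ (λ x₁ → NZ G x₀ × NZ G x₁ ×
      Σ ℕ (λ m → Σ ℕ (λ n → m ≢ n × Σ ℚ (λ k →
        (k ≡ ℕ→ℚ d * x₀ * x₁ * (ℕ→ℚ m - ℕ→ℚ n)) ×
        ((l : ℕ) → (k * C l zero ≡ p * ℕ→ℚ d * x₁ * (ℕ→ℚ l - ℕ→ℚ n))
                 × (k * C l (suc zero) ≡ p * ℕ→ℚ d * x₀ * (ℕ→ℚ m - ℕ→ℚ l))))))))
lemma3p2 G G-subgroup _ _ d p (inj₁ (1∈G , _ , refl)) C covers =
  affineRows G-subgroup d (ℕ→ℚ≢0 d) C covers 1ℚ 1∈G λ ()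
lemma3p2 G G-subgroup _ _ d p (inj₂ (_ , d∈G , refl)) C covers =
  affineRows G-subgroup d (ℕ→ℚ≢0 d) C covers (ℕ→ℚ d) d∈G (ℕ→ℚ≢0 d)
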